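{- Let $\mathcal{A}$ be a nice GFG-tNCW and let $q,s$ be states of $\mathcal{A}$ with $q\approx s$ (respectively, $q\precsim s$). Then for every letter $\sigma\in\Sigma$ and every $\bar\alpha$-transition $\langle q,\sigma,q'\rangle$ of $\mathcal{A}$, there is an $\bar\alpha$-transition $\langle s,\sigma,s'\rangle$ of $\mathcal{A}$ with $q'\approx s'$ (respectively, $q'\precsim s'$).
   Context: A tNCW is $\mathcal{A}=\langle \Sigma,Q,q_0,\delta,\alpha\rangle$ with finite alphabet $\Sigma$, finite state set $Q$, initial state $q_0$, total transition function $\delta:Q\times\Sigma\to 2^Q\setminus\{\emptyset\}$ with transition relation $\Delta=\{\langle q,\sigma,s\rangle: s\in\delta(q,\sigma)\}$, and $\alpha\subseteq\Delta$ ($\alpha$-transitions; the rest are $\bar\alpha$-transitions); $\delta^{\bar\alpha}(q,\sigma)$ is the set of $\sigma$-successors of $q$ via $\bar\alpha$-transitions. A run on $w=\sigma_1\sigma_2\cdots$ is $r_0r_1\cdots$ with $r_0=q_0$, $r_{i+1}\in\delta(r_i,\sigma_{i+1})$, accepting iff it traverses $\alpha$-transitions only finitely often. $\mathcal{A}^q$ is $\mathcal{A}$ with initial state $q$. $\mathcal{A}$ is GFG if there is $f:\Sigma^*\to Q$ with $f(\epsilon)=q_0$, $\langle f(u),\sigma,f(u\sigma)\rangle\in\Delta$ for all $u,\sigma$, and for every $w\in L(\mathcal{A})$ the run $f(w[1,0]),f(w[1,1]),\dots$ is accepting; a state $q$ is GFG if $\mathcal{A}^q$ is. A run is safe if it uses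 no $\alpha$-transition; $L_{safe}(\mathcal{A}^q)$ is the set of infinite words with a safe run from $q$. $q\sim s$ iff $L(\mathcal{A}^q)=L(\mathcal{A}^s)$; $q\approx s$ iff $q\sim s$ and $L_{safe}(\mathcal{A}^q)=L_{safe}(\mathcal{A}^s)$; $q\precsim s$ iff $q\sim s$ and $L_{safe}(\mathcal{A}^q)\subseteq L_{safe}(\mathcal{A}^s)$. $\mathcal{A}$ is semantically deterministic if any two $\sigma$-successors of a state are $\sim$-equivalent; safe deterministic if $|\delta^{\bar\alpha}(q,\sigma)|\le1$; normal if a path of $\bar\alpha$-transitions from $q$ to $s$ implies one from $s$ to $q$. A GFG-tNCW is nice if all states are reachable and GFG and it is normal, safe deterministic and semantically deterministic. -}

module Defs where

open import Data.Nat using (ℕ; zero; suc; _≥_)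
open import Data.Fin using (Fin)
open import Data.Bool using (Bool; true; false)
open import Data.List using (List; []; _∷_; _∷ʳ_)
open import Data.Product using (Σ; ∃; ∃-syntax; _×_; _,_)
open import Relation.Binary.PropositionalEquality using (_≡_)

-- A tNCW over the finite alphabet Fin k with finite state set Fin n.
-- δ q σ s ≡ true  iff  ⟨q,σ,s⟩ ∈ Δ.
-- α q σ s ≡ true  marks the transition as an α-transition (only meaningful
-- for transitions in Δ, so α ⊆ Δ is built into the definitions below).
record tNCW (k n : ℕ) : Set where
  field
    q₀    : Fin n
    δ     : Fin n → Fin k → Fin n → Bool
    total : ∀ q σ → ∃[ s ] (δ q σ s ≡ true)
    α     : Fin n → Fin k → Fin n → Bool

-- infinite words σ₁σ₂⋯ : letter σ_{i+1} is  w i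
Word : ℕ → Set
Word k = ℕ → Fin k

prefix : ∀ {k} → Word k → ℕ → List (Fin k)
prefix w zero = []
prefix w (suc i) = prefix w i ∷ʳ w i

module _ {k n : ℕ} (A : tNCW k n) where
  open tNCW A

  Trans : Fin n → Fin k → Fin n → Set
  Trans q σ s = δ q σ s ≡ true

  αTrans : Fin n → Fin k → Fin n → Set
  αTrans q σ s = (δ q σ s ≡ true) × (α q σ s ≡ true)

  ᾱTrans : Fin n → Fin k → Fin n → Set
  ᾱTrans q σ s = (δ q σ s ≡ true) × (α q σ s ≡ false)

  IsRun : Fin n → Word k → (ℕ → Fin n) → Set
  IsRun q w r = (r 0 ≡ q) × (∀ i → Trans (r i) (w i) (r (suc i)))

  AcceptingRun : Word k → (ℕ → Fin n) → Set
  AcceptingRun w r = ∃[ N ] (∀ i → i ≥ N → α (r i) (w i) (r (suc i)) ≡ false)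

  SafeRun : Word k → (ℕ → Fin n) → Set
  SafeRun w r = ∀ i → α (r i) (w i) (r (suc i)) ≡ false

  L : Fin n → Word k → Set
  L q w = ∃[ r ] (IsRun q w r × AcceptingRun w r)

  Lsafe : Fin n → Word k → Set
  Lsafe q w = ∃[ r ] (IsRun q w r × SafeRun w r)

  _∼_ : Fin n → Fin n → Set
  q ∼ s = ∀ w → (L q w → L s w) × (L s w → L q w)

  _≈_ : Fin n → Fin n → Set
  q ≈ s = (q ∼ s) × (∀ w → (Lsafe q w → Lsafe s w) × (Lsafe s w → Lsafe q w))

  _≾_ : Fin n → Fin n → Set
  q ≾ s = (q ∼ s) × (∀ w → Lsafe q w → Lsafe s w)

  IsGFGFrom : Fin n → Set
  IsGFGFrom q = Σ (List (Fin k) → Fin n) λ f →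
      (f [] ≡ q)
    × (∀ u σ → Trans (f u) σ (f (u ∷ʳ σ)))
    × (∀ w → L q w → AcceptingRun w (λ i → f (prefix w i)))

  IsGFG : Set
  IsGFG = IsGFGFrom q₀

  data Path : Fin n → List (Fin k) → Fin n → Set where
    here : ∀ {q} → Path q [] q
    step : ∀ {q σ q' u s} → Trans q σ q' → Path q' u s → Path q (σ ∷ u) s

  data SafePath : Fin n → List (Fin k) → Fin n → Set where
    here : ∀ {q} → SafePath q [] q
    step : ∀ {q σ q' u s} → ᾱTrans q σ q' → SafePath q' u s → SafePath q (σ ∷ u) s

  Reachable : Fin n → Set
  Reachable q = ∃[ u ] Path q₀ u q

  Normal : Set
  Normal = ∀ q s → (∃[ u ] SafePath q u s) → ∃[ v ] SafePath s v q

  SafeDeterministic : Set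
  SafeDeterministic = ∀ q σ s₁ s₂ → ᾱTrans q σ s₁ → ᾱTrans q σ s₂ → s₁ ≡ s₂

  SemanticallyDeterministic : Set
  SemanticallyDeterministic = ∀ q σ s₁ s₂ → Trans q σ s₁ → Trans q σ s₂ → s₁ ∼ s₂

  record Nice : Set where
    field
      gfg        : IsGFG
      reachable  : ∀ q → Reachable q
      allGFG     : ∀ q → IsGFGFrom q
      normal     : Normal
      safeDet    : SafeDeterministic
      semDet     : SemanticallyDeterministic

-- Semantic determinism transfers ∼ from q, s to any pair of σ-successors, and safe
-- determinism transfers inclusion of safe languages from q, s to their unique
-- ᾱ-successors. The only real point is that s has an ᾱ-successor on σ at all: by
-- normality the ᾱ-transition ⟨q,σ,q'⟩ lies on a safe cycle, whose periodic word is in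
-- L_safe(A^q) ⊆ L_safe(A^s), and a safe run of s on it starts with an ᾱ-transition on σ.
module Submission where

open import Defs
open import Data.Nat using (ℕ; zero; suc; s≤s)
open import Data.Nat.Properties using (m≤n⇒m≤1+n)
open import Data.Fin using (Fin)
open import Data.List using (List; []; _∷_)
open import Data.Product using (∃-syntax; _×_; _,_; proj₁; proj₂)
open import Relation.Binary.PropositionalEquality using (_≡_; refl; subst)

_◃_ : ∀ {A : Set} → A → (ℕ → A) → ℕ → A
(a ◃ f) zero = a
(a ◃ f) (suc i) = f i

tail : ∀ {A : Set} → (ℕ → A) → ℕ → A
tail f i = f (suc i)

module _ {k n : ℕ} (A : tNCW k n) where

  _⊆safe_ : Fin n → Fin n → Set
  q ⊆safe s = ∀ w → Lsafe A q w → Lsafe A s w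

  ∼-sym : ∀ {q s} → _∼_ A q s → _∼_ A s q
  ∼-sym q∼s w = proj₂ (q∼s w) , proj₁ (q∼s w)

  L-uncons : ∀ q w → L A q w → ∃[ q' ] (Trans A q (w 0) q' × L A q' (tail w))
  L-uncons .(r 0) w (r , (refl , trans) , N , acc) =
    r 1 , trans 0 , tail r , (refl , λ i → trans (suc i)) , N , λ i i≥N → acc (suc i) (m≤n⇒m≤1+n i≥N)

  L-cons : ∀ {q σ q'} w → Trans A q σ q' → L A q' w → L A q (σ ◃ w)
  L-cons {q} w t (r , (refl , trans) , N , acc) =
    (q ◃ r) , (refl , λ { zero → t ; (suc i) → trans i }) ,
    suc N , λ { zero () ; (suc i) (s≤s i≥N) → acc i i≥N }

  Lsafe-uncons : ∀ q w → Lsafe A q w → ∃[ q' ] (ᾱTrans A q (w 0) q' × Lsafe A q' (tail w))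
  Lsafe-uncons .(r 0) w (r , (refl , trans) , safe) =
    r 1 , (trans 0 , safe 0) , tail r , (refl , λ i → trans (suc i)) , λ i → safe (suc i)

  Lsafe-cons : ∀ {q σ q'} w → ᾱTrans A q σ q' → Lsafe A q' w → Lsafe A q (σ ◃ w)
  Lsafe-cons {q} w (t , t-safe) (r , (refl , trans) , safe) =
    (q ◃ r) , (refl , λ { zero → t ; (suc i) → trans i }) ,
    λ { zero → t-safe ; (suc i) → safe i }

  module SafeLoop {q : Fin n} {a : Fin k} {v : List (Fin k)} (loop : SafePath A q (a ∷ v) q) where

    -- A position on the loop: the current state together with the nonempty rest of
    -- the loop back to q, so the next letter is always available.
    record Position : Set where
      constructor at
      field
        {state}  : Fin n
        {letter} : Fin k
        {rest}   : List (Fin k)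
        toStart  : SafePath A state (letter ∷ rest) q
    open Position

    advance : Position → Position
    advance (at (step _ here))       = at loop
    advance (at (step _ (step t p))) = at (step t p)

    advance-ᾱTrans : ∀ P → ᾱTrans A (state P) (letter P) (state (advance P))
    advance-ᾱTrans (at (step t here))      = t
    advance-ᾱTrans (at (step t (step _ _))) = t

    position : ℕ → Position
    position zero    = at loop
    position (suc i) = advance (position i)

    word : Word k
    word i = letter (position i)

    word-∈-Lsafe : Lsafe A q word
    word-∈-Lsafe =
      (λ i → state (position i)) ,
      (refl , λ i → proj₁ (advance-ᾱTrans (position i))) ,
      λ i → proj₂ (advance-ᾱTrans (position i))

  ᾱ-successor-exists : Normal A → ∀ {q s σ q'} → q ⊆safe s → ᾱTrans A q σ q' →
                       ∃[ s' ] ᾱTrans A s σ s'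
  ᾱ-successor-exists normal {q} {s} {σ} {q'} q⊆s t
    with normal q q' (σ ∷ [] , step t here)
  ... | _ , back =
    let open SafeLoop (step t back)
        (s' , s→s' , _) = Lsafe-uncons s word (q⊆s word word-∈-Lsafe)
    in s' , s→s'

  L-⊆-successor : SemanticallyDeterministic A → ∀ {q s σ q' s'} → _∼_ A q s →
                  Trans A q σ q' → Trans A s σ s' → ∀ w → L A q' w → L A s' w
  L-⊆-successor semDet {s = s} {σ} {s' = s'} q∼s q→q' s→s' w w∈q'
    with L-uncons s (σ ◃ w) (proj₁ (q∼s (σ ◃ w)) (L-cons w q→q' w∈q'))
  ... | p , s→p , w∈p = proj₁ (semDet s σ p s' s→p s→s' w) w∈p

  ∼-successor : SemanticallyDeterministic A → ∀ {q s σ q' s'} → _∼_ A q s →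
                Trans A q σ q' → Trans A s σ s' → _∼_ A q' s'
  ∼-successor semDet q∼s q→q' s→s' w =
    L-⊆-successor semDet q∼s q→q' s→s' w ,
    L-⊆-successor semDet (∼-sym q∼s) s→s' q→q' w

  ⊆safe-successor : SafeDeterministic A → ∀ {q s σ q' s'} → q ⊆safe s →
                    ᾱTrans A q σ q' → ᾱTrans A s σ s' → q' ⊆safe s'
  ⊆safe-successor safeDet {s = s} {σ} {s' = s'} q⊆s q→q' s→s' w w∈q'
    with Lsafe-uncons s (σ ◃ w) (q⊆s (σ ◃ w) (Lsafe-cons w q→q' w∈q'))
  ... | p , s→p , w∈p = subst (λ x → Lsafe A x w) (safeDet s σ p s' s→p s→s') w∈p

  module _ (nice : Nice A) where
    open Nice nice

    ≈-successor : ∀ q s → _≈_ A q s → ∀ σ q' → ᾱTrans A q σ q' →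
                  ∃[ s' ] (ᾱTrans A s σ s' × _≈_ A q' s')
    ≈-successor q s (q∼s , q≡ₛs) σ q' q→q' =
      let q⊆s w = proj₁ (q≡ₛs w)
          s⊆q w = proj₂ (q≡ₛs w)
          (s' , s→s') = ᾱ-successor-exists normal q⊆s q→q'
      in s' , s→s' ,
         ∼-successor semDet q∼s (proj₁ q→q') (proj₁ s→s') ,
         λ w → ⊆safe-successor safeDet q⊆s q→q' s→s' w ,
               ⊆safe-successor safeDet s⊆q s→s' q→q' w

    ≾-successor : ∀ q s → _≾_ A q s → ∀ σ q' → ᾱTrans A q σ q' →
                  ∃[ s' ] (ᾱTrans A s σ s' × _≾_ A q' s')
    ≾-successor q s (q∼s , q⊆s) σ q' q→q' =
      let (s' , s→s') = ᾱ-successor-exists normal q⊆s q→q'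
      in s' , s→s' ,
         ∼-successor semDet q∼s (proj₁ q→q') (proj₁ s→s') ,
         ⊆safe-successor safeDet q⊆s q→q' s→s'

proposition3p2 : ∀ {k n : ℕ} (A : tNCW k n) → Nice A →
    (∀ (q s : Fin n) → _≈_ A q s → ∀ (σ : Fin k) (q' : Fin n) → ᾱTrans A q σ q' →
       ∃[ s' ] (ᾱTrans A s σ s' × _≈_ A q' s'))
    × (∀ (q s : Fin n) → _≾_ A q s → ∀ (σ : Fin k) (q' : Fin n) → ᾱTrans A q σ q' →
       ∃[ s' ] (ᾱTrans A s σ s' × _≾_ A q' s'))
proposition3p2 A nice = ≈-successor A nice , ≾-successor A nice
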